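{- Let $G$ be a connected graph (no loops, no multiple edges), $b\in V_G$, $\ell\in\mathbb{Z}_{\ge0}$. The assignment $\mathbf{x}\mapsto(\overline{\mathbf{x}},L_{\mathbf{x}})$ is a well-defined bijection $f:\mathcal{V}_{G,b,\ell}\to\operatorname{Tab}_{G,b,\ell}$.
   Context: The workspace $W_G$ has vertices $V_G\times\mathbb{Z}_{\ge0}$, with $G(v,h)=v$, $\mathrm{ht}(v,h)=h$; edges are horizontal $\{(v,h),(w,h)\}$ for $\{v,w\}\in E_G$ and vertical $\{(v,h),(v,h+1)\}$. A configuration is a cycle-free path $\mathbf{x}$ in $W_G$ with vertices $x_0,\dots,x_\ell$, edges $\mathbf{x}_i=\{x_{i-1},x_i\}$, $x_0=(b,0)$ and $\mathrm{ht}(x_0)\le\dots\le\mathrm{ht}(x_\ell)$; $\mathcal{V}_{G,b,\ell}$ is their set. If $i_1<\dots<i_t$ are the indices of the horizontal edges of $\mathbf{x}$, then $\overline{\mathbf{x}}$ is the $G$-path starting at $b$ with edges $G(\mathbf{x}_{i_1}),\dots,G(\mathbf{x}_{i_t})$ (projections to $G$), and $L_{\mathbf{x}}:[1,t]\to\mathbb{Z}_{\ge0}$, $L_{\mathbf{x}}(r)$ = the height of the edge $\mathbf{x}_{i_r}$. A $G$-path $\mathbf{p}$ has length $\#\mathbf{p}$, edges $\mathbf{p}_i=\{p_{i-1},p_i\}$, vertices $p_0,\dots,p_{\#\mathbf{p}}$. A $(G,b,\ell)$-tableau is $(\mathbf{p},L)$ with $\mathbf{p}$ a $G$-path, $p_0=b$,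 $L:[1,\#\mathbf{p}]\to\mathbb{Z}_{\ge0}$ with (i) $L$ weakly increasing, (ii) $i<j$, $p_{i-1}=p_j$ imply $L(i)<L(j)$, (iii) $L(\#\mathbf{p})+\#\mathbf{p}\le\ell$; $\operatorname{Tab}_{G,b,\ell}$ is their set (including the length-$0$ path with empty labeling). -}

module Defs where

open import Data.Nat using (ℕ; zero; suc; _+_; _≤_; _<_; _≟_)
open import Data.Fin using (Fin; inject₁; fromℕ) renaming (zero to fzero; suc to fsuc; _<_ to _<ᶠ_; _≤_ to _≤ᶠ_)
open import Data.Vec using (Vec; []; _∷_; lookup; head; last)
open import Data.Product using (Σ; _×_; _,_; proj₁; proj₂)
open import Data.Sum using (_⊎_)
open import Data.Unit using (⊤)
open import Relation.Nullary using (¬_; yes; no)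
open import Relation.Binary.PropositionalEquality using (_≡_)

-- A finite simple graph on vertex set Fin n: a symmetric, irreflexive
-- adjacency relation (no loops; multiple edges are impossible by construction).
record Graph (n : ℕ) : Set₁ where
  field
    Adj    : Fin n → Fin n → Set
    sym    : ∀ {u v} → Adj u v → Adj v u
    irrefl : ∀ {u} → ¬ Adj u u

open Graph public

IsWalk : ∀ {A : Set} {m : ℕ} → (A → A → Set) → Vec A (suc m) → Set
IsWalk {m = m} R w = (k : Fin m) → R (lookup w (inject₁ k)) (lookup w (fsuc k))

Connected : ∀ {n} → Graph n → Set
Connected {n} G = (u v : Fin n) → Σ ℕ λ m → Σ (Vec (Fin n) (suc m)) λ w →
  (head w ≡ u) × (last w ≡ v) × IsWalk (Adj G) w

WVert : ℕ → Set
WVert n = Fin n × ℕ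

WAdj : ∀ {n} → Graph n → WVert n → WVert n → Set
WAdj G (v , h) (w , h') =
  (Adj G v w × h ≡ h') ⊎ (v ≡ w × ((h' ≡ suc h) ⊎ (h ≡ suc h')))

record IsConfig {n} (G : Graph n) (b : Fin n) (ℓ : ℕ) (x : Vec (WVert n) (suc ℓ)) : Set where
  field
    start     : lookup x fzero ≡ (b , 0)
    path      : IsWalk (WAdj G) x
    cycleFree : (i j : Fin (suc ℓ)) → lookup x i ≡ lookup x j → i ≡ j
    heightMono : (k : Fin ℓ) → proj₂ (lookup x (inject₁ k)) ≤ proj₂ (lookup x (fsuc k))

-- Raw tableau data (p , L): number of edges t, vertices p_0..p_t, labels
-- L(1)..L(t) (stored at Vec positions 0..t-1).
RawTab : ℕ → Set
RawTab n = Σ ℕ λ t → Vec (Fin n) (suc t) × Vec ℕ t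

-- condition (iii): L(#p) + #p ≤ ℓ (vacuous for the length-0 path)
LastCond : ∀ {t} → Vec ℕ t → ℕ → Set
LastCond {zero} L ℓ = ⊤
LastCond {suc m} L ℓ = lookup L (fromℕ m) + suc m ≤ ℓ

record IsTableau {n} (G : Graph n) (b : Fin n) (ℓ : ℕ) (T : RawTab n) : Set where
  field
    start   : lookup (proj₁ (proj₂ T)) fzero ≡ b
    gpath   : IsWalk (Adj G) (proj₁ (proj₂ T))
    mono    : (k k' : Fin (proj₁ T)) → k ≤ᶠ k' →
              lookup (proj₂ (proj₂ T)) k ≤ lookup (proj₂ (proj₂ T)) k'
    -- (ii) i < j and p_{i-1} = p_j imply L(i) < L(j)   (i = k+1, j = k'+1)
    strict  : (k k' : Fin (proj₁ T)) → k <ᶠ k' →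
              lookup (proj₁ (proj₂ T)) (inject₁ k) ≡ lookup (proj₁ (proj₂ T)) (fsuc k') →
              lookup (proj₂ (proj₂ T)) k < lookup (proj₂ (proj₂ T)) k'
    bound   : LastCond (proj₂ (proj₂ T)) ℓ

-- Collect the horizontal edges (equal heights at both ends) of a vertex
-- sequence, in order: for each, the G-projection of its later endpoint
-- (the next vertex of the projected G-path) and its height.
private
  consH : ∀ {n} → Fin n → ℕ → (Σ ℕ λ t → Vec (Fin n) t × Vec ℕ t) →
          Σ ℕ λ t → Vec (Fin n) t × Vec ℕ t
  consH w h (t , ps , ls) = suc t , w ∷ ps , h ∷ ls

horiz : ∀ {n m} → WVert n → Vec (WVert n) m → Σ ℕ λ t → Vec (Fin n) t × Vec ℕ t
horiz prev [] = 0 , [] , []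
horiz (v , h) ((w , h') ∷ xs) with h ≟ h'
... | yes _ = consH w h (horiz (w , h') xs)
... | no _  = horiz (w , h') xs

fMap : ∀ {n ℓ} → Fin n → Vec (WVert n) (suc ℓ) → RawTab n
fMap b (x ∷ xs) with horiz x xs
... | (t , ps , ls) = t , b ∷ ps , ls

{-# OPTIONS --safe #-}
module Submission where

open import Defs
open import Data.Nat using (ℕ; suc)
open import Data.Fin using (Fin)
open import Data.Vec using (Vec)
open import Data.Product using (Σ; _×_)
open import Relation.Binary.PropositionalEquality using (_≡_)

open import Data.Empty using (⊥-elim)
open import Data.Fin using (inject₁; fromℕ) renaming (zero to fzero; suc to fsuc; _<_ to _<ᶠ_; _≤_ to _≤ᶠ_)
open import Data.Fin.Properties using (suc-injective; ≤fromℕ)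
open import Data.Nat using (zero; _+_; _≤_; _<_; _≟_; z≤n; s≤s)
open import Data.Nat.Properties
  using (≤-refl; ≤-trans; ≤-reflexive; ≤-pred; n≤1+n; m≤n⇒m≤1+n; 1+n≰n; m+1+n≰m;
         ≤∧≢⇒<; <-irrefl; +-suc; +-identityʳ; +-monoʳ-≤; +-monoˡ-≤)
open import Data.Product using (_,_; proj₁; proj₂)
open import Data.Sum using (inj₁; inj₂)
open import Data.Unit using (tt)
open import Data.Vec using ([]; _∷_; lookup)
open import Relation.Binary.PropositionalEquality
  using (_≢_; refl; trans; cong; cong₂; subst; subst₂; module ≡-Reasoning)
  renaming (sym to ≡-sym)
open import Relation.Nullary using (yes; no)

-- A configuration is a climb through W_G: every step either follows an edge
-- of G at the current height or goes up by one.  Its tableau records the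
-- horizontal steps with their heights.  Between two horizontal steps the
-- climb goes straight up, so the labels determine the climb; and since the
-- heights never decrease, a vertex is revisited only by horizontal steps at
-- one height, which is what condition (ii) forbids.  Conversely a tableau is
-- realised by climbing at the current vertex until the height reaches the
-- next label and then taking the next edge; (iii) says that ℓ steps suffice.

walk-∷ : ∀ {A : Set} (R : A → A → Set) {m x y} {ys : Vec A m} →
  R x y → IsWalk R (y ∷ ys) → IsWalk R (x ∷ y ∷ ys)
walk-∷ R r w fzero    = r
walk-∷ R r w (fsuc k) = w k

Distinct : ∀ {A : Set} {m} → Vec A m → Set
Distinct {m = m} xs = (i j : Fin m) → lookup xs i ≡ lookup xs j → i ≡ j

module _ {A : Set} {m} {x : A} {ys : Vec A m} where

  Distinct-∷ : (∀ j → x ≢ lookup ys j) → Distinct ys → Distinct (x ∷ ys)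
  Distinct-∷ x∉ys d fzero    fzero    _  = refl
  Distinct-∷ x∉ys d fzero    (fsuc j) eq = ⊥-elim (x∉ys j eq)
  Distinct-∷ x∉ys d (fsuc i) fzero    eq = ⊥-elim (x∉ys i (≡-sym eq))
  Distinct-∷ x∉ys d (fsuc i) (fsuc j) eq = cong fsuc (d i j eq)

  Distinct-head : Distinct (x ∷ ys) → ∀ j → x ≢ lookup ys j
  Distinct-head d j eq with d fzero (fsuc j) eq
  ... | ()

  Distinct-tail : Distinct (x ∷ ys) → Distinct ys
  Distinct-tail d i j eq = suc-injective (d (fsuc i) (fsuc j) eq)

_≤ʰ_ : ∀ {n} → WVert n → WVert n → Set
a ≤ʰ c = proj₂ a ≤ proj₂ c

Ascending : ∀ {n m} → Vec (WVert n) (suc m) → Set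
Ascending = IsWalk _≤ʰ_

-- Edge lists p₁ … pₜ, L(1) … L(t) as produced by horiz; withRoot adds p₀.
Edges : ℕ → Set
Edges n = Σ ℕ λ t → Vec (Fin n) t × Vec ℕ t

module _ {n : ℕ} where

  size : Edges n → ℕ
  size = proj₁

  targets : (r : Edges n) → Vec (Fin n) (size r)
  targets r = proj₁ (proj₂ r)

  labels : (r : Edges n) → Vec ℕ (size r)
  labels r = proj₂ (proj₂ r)

  consEdge : Fin n → ℕ → Edges n → Edges n
  consEdge w h r = suc (size r) , w ∷ targets r , h ∷ labels r

  withRoot : Fin n → Edges n → RawTab n
  withRoot b r = size r , b ∷ targets r , labels r

  consEdge-injective : ∀ {w w' h h'} (r r' : Edges n) →
    consEdge w h r ≡ consEdge w' h' r' → w ≡ w' × r ≡ r'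
  consEdge-injective (t , ps , ls) (.t , .ps , .ls) refl = refl , refl

  withRoot-injective : ∀ {b} (r r' : Edges n) → withRoot b r ≡ withRoot b r' → r ≡ r'
  withRoot-injective (t , ps , ls) (.t , .ps , .ls) refl = refl

Above : ∀ {t} → ℕ → Vec ℕ t → Set
Above {t} h ls = (j : Fin t) → h ≤ lookup ls j

Monotone : ∀ {t} → Vec ℕ t → Set
Monotone {t} ls = (k k' : Fin t) → k ≤ᶠ k' → lookup ls k ≤ lookup ls k'

StrictAtRepeats : ∀ {n t} → Fin n → Vec (Fin n) t → Vec ℕ t → Set
StrictAtRepeats {t = t} v ps ls = (k k' : Fin t) → k <ᶠ k' →
  lookup (v ∷ ps) (inject₁ k) ≡ lookup (v ∷ ps) (fsuc k') → lookup ls k < lookup ls k'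

Monotone-tail : ∀ {t l} {ls : Vec ℕ t} → Monotone (l ∷ ls) → Monotone ls
Monotone-tail mono k k' k≤k' = mono (fsuc k) (fsuc k') (s≤s k≤k')

Above-suc : ∀ {t h l} {ls : Vec ℕ t} → Above h (l ∷ ls) → Monotone (l ∷ ls) → h ≢ l →
  Above (suc h) (l ∷ ls)
Above-suc above mono h≢l j = ≤-trans (≤∧≢⇒< (above fzero) h≢l) (mono fzero j z≤n)

Bounded : ∀ {t} → ℕ → Vec ℕ t → Set
Bounded {t} ℓ ls = (j : Fin t) → lookup ls j + t ≤ ℓ

Bounded⇒LastCond : ∀ {t ℓ} (ls : Vec ℕ t) → Bounded ℓ ls → LastCond ls ℓ
Bounded⇒LastCond {zero}  ls bd = tt
Bounded⇒LastCond {suc t} ls bd = bd (fromℕ t)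

LastCond⇒Bounded : ∀ {t ℓ} (ls : Vec ℕ t) → Monotone ls → LastCond ls ℓ → Bounded ℓ ls
LastCond⇒Bounded {suc t} ls mono last j =
  ≤-trans (+-monoˡ-≤ (suc t) (mono j (fromℕ t) (≤fromℕ j))) last

+-suc-mono-≤ : ∀ a t h m → a + t ≤ h + m → a + suc t ≤ h + suc m
+-suc-mono-≤ a t h m p = subst₂ _≤_ (≡-sym (+-suc a t)) (≡-sym (+-suc h m)) (s≤s p)

+-suc-cancel-≤ : ∀ a t h m → a + suc t ≤ h + suc m → a + t ≤ h + m
+-suc-cancel-≤ a t h m p = ≤-pred (subst₂ _≤_ (+-suc a t) (+-suc h m) p)

climbAlong : ∀ {n t} → WVert n → (m : ℕ) → Vec (Fin n) t → Vec ℕ t → Vec (WVert n) m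
climbAlong c       zero    ps       ls       = []
climbAlong (v , h) (suc m) []       []       = (v , suc h) ∷ climbAlong (v , suc h) m [] []
climbAlong (v , h) (suc m) (w ∷ ps) (l ∷ ls) with h ≟ l
... | yes _ = (w , h) ∷ climbAlong (w , h) m ps ls
... | no _  = (v , suc h) ∷ climbAlong (v , suc h) m (w ∷ ps) (l ∷ ls)

climbAlong-avoids : ∀ {n t} m {v u : Fin n} {h h'} {ps : Vec (Fin n) t} {ls : Vec ℕ t} →
  h ≤ h' → (∀ j → u ≡ lookup ps j → h < lookup ls j) →
  ∀ i → (u , h) ≢ lookup (climbAlong (v , h') m ps ls) i
climbAlong-avoids (suc m) {ps = []} {[]} h≤h' _ fzero eq =
  1+n≰n (subst (_≤ _) (cong proj₂ eq) h≤h')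
climbAlong-avoids (suc m) {ps = []} {[]} h≤h' u-later (fsuc i) =
  climbAlong-avoids m (m≤n⇒m≤1+n h≤h') u-later i
climbAlong-avoids (suc m) {h' = h'} {w ∷ ps} {l ∷ ls} h≤h' u-later i with h' ≟ l | i
... | yes refl | fzero  = λ eq → <-irrefl (cong proj₂ eq) (u-later fzero (cong proj₁ eq))
... | yes refl | fsuc i = climbAlong-avoids m h≤h' (λ j → u-later (fsuc j)) i
... | no _     | fzero  = λ eq → 1+n≰n (subst (_≤ _) (cong proj₂ eq) h≤h')
... | no _     | fsuc i = climbAlong-avoids m (m≤n⇒m≤1+n h≤h') u-later i

module _ {n} (G : Graph n) where

  adjacent⇒≢ : ∀ {v w} → Adj G v w → v ≢ w
  adjacent⇒≢ a refl = irrefl G a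

  data Step : WVert n → WVert n → Set where
    horizontal : ∀ {v w h} → Adj G v w → Step (v , h) (w , h)
    vertical   : ∀ {v h} → Step (v , h) (v , suc h)

  step : ∀ {a c} → WAdj G a c → a ≤ʰ c → Step a c
  step (inj₁ (a , refl))          _  = horizontal a
  step (inj₂ (refl , inj₁ refl))  _  = vertical
  step (inj₂ (refl , inj₂ refl)) le = ⊥-elim (1+n≰n le)

  data Climb : ∀ {m} → WVert n → Vec (WVert n) m → Set where
    []  : ∀ {c} → Climb c []
    _∷_ : ∀ {m c d} {xs : Vec (WVert n) m} → Step c d → Climb d xs → Climb c (d ∷ xs)

  climb : ∀ {m c} {xs : Vec (WVert n) m} → IsWalk (WAdj G) (c ∷ xs) → Ascending (c ∷ xs) → Climb c xs
  climb {xs = []}    _    _   = []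
  climb {xs = _ ∷ _} walk asc =
    step (walk fzero) (asc fzero) ∷ climb (λ k → walk (fsuc k)) (λ k → asc (fsuc k))

  Climb⇒walk : ∀ {m c} {xs : Vec (WVert n) m} → Climb c xs → IsWalk (WAdj G) (c ∷ xs)
  Climb⇒walk []                  = λ ()
  Climb⇒walk (horizontal a ∷ cl) = walk-∷ (WAdj G) (inj₁ (a , refl)) (Climb⇒walk cl)
  Climb⇒walk (vertical ∷ cl)     = walk-∷ (WAdj G) (inj₂ (refl , inj₁ refl)) (Climb⇒walk cl)

  Climb⇒ascending : ∀ {m c} {xs : Vec (WVert n) m} → Climb c xs → Ascending (c ∷ xs)
  Climb⇒ascending []                      = λ ()
  Climb⇒ascending (horizontal _ ∷ cl)     = walk-∷ _≤ʰ_ ≤-refl (Climb⇒ascending cl)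
  Climb⇒ascending (vertical {h = h} ∷ cl) = walk-∷ _≤ʰ_ (n≤1+n h) (Climb⇒ascending cl)

  edges : ∀ {m c} {xs : Vec (WVert n) m} → Climb c xs → Edges n
  edges []                               = 0 , [] , []
  edges (horizontal {w = w} {h} _ ∷ cl) = consEdge w h (edges cl)
  edges (vertical ∷ cl)                  = edges cl

  horiz≡edges : ∀ {m c} {xs : Vec (WVert n) m} (cl : Climb c xs) → horiz c xs ≡ edges cl
  horiz≡edges []                              = refl
  horiz≡edges (horizontal {w = w} {h} _ ∷ cl) with h ≟ h
  ... | yes _   = cong (consEdge w h) (horiz≡edges cl)
  ... | no h≢h  = ⊥-elim (h≢h refl)
  horiz≡edges (vertical {h = h} ∷ cl) with h ≟ suc h
  ... | yes h≡1+h = ⊥-elim (1+n≰n (≤-reflexive (≡-sym h≡1+h)))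
  ... | no _      = horiz≡edges cl

  size-edges≤ : ∀ {m c} {xs : Vec (WVert n) m} (cl : Climb c xs) → size (edges cl) ≤ m
  size-edges≤ []                  = z≤n
  size-edges≤ (horizontal _ ∷ cl) = s≤s (size-edges≤ cl)
  size-edges≤ (vertical ∷ cl)     = m≤n⇒m≤1+n (size-edges≤ cl)

  edges-occur : ∀ {m c} {xs : Vec (WVert n) m} (cl : Climb c xs) (j : Fin (size (edges cl))) →
    Σ (Fin m) λ i → lookup xs i ≡ (lookup (targets (edges cl)) j , lookup (labels (edges cl)) j)
  edges-occur (horizontal _ ∷ cl) fzero = fzero , refl
  edges-occur (horizontal _ ∷ cl) (fsuc j) with edges-occur cl j
  ... | i , eq = fsuc i , eq
  edges-occur (vertical ∷ cl) j with edges-occur cl j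
  ... | i , eq = fsuc i , eq

  edges-walk : ∀ {m v h} {xs : Vec (WVert n) m} (cl : Climb (v , h) xs) →
    IsWalk (Adj G) (v ∷ targets (edges cl))
  edges-walk []                  = λ ()
  edges-walk (horizontal a ∷ cl) = walk-∷ (Adj G) a (edges-walk cl)
  edges-walk (vertical ∷ cl)     = edges-walk cl

  edges-above : ∀ {m v h} {xs : Vec (WVert n) m} (cl : Climb (v , h) xs) → Above h (labels (edges cl))
  edges-above []                  ()
  edges-above (horizontal _ ∷ cl) fzero    = ≤-refl
  edges-above (horizontal _ ∷ cl) (fsuc j) = edges-above cl j
  edges-above (vertical {h = h} ∷ cl) j    = ≤-trans (n≤1+n h) (edges-above cl j)

  edges-monotone : ∀ {m c} {xs : Vec (WVert n) m} (cl : Climb c xs) → Monotone (labels (edges cl))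
  edges-monotone []                  ()
  edges-monotone (horizontal a ∷ cl) fzero    k'        _       = edges-above (horizontal a ∷ cl) k'
  edges-monotone (horizontal _ ∷ cl) (fsuc k) (fsuc k') (s≤s p) = edges-monotone cl k k' p
  edges-monotone (vertical ∷ cl)     k        k'        p       = edges-monotone cl k k' p

  edges-strict : ∀ {m v h} {xs : Vec (WVert n) m} (cl : Climb (v , h) xs) → Distinct ((v , h) ∷ xs) →
    StrictAtRepeats v (targets (edges cl)) (labels (edges cl))
  edges-strict []                  d ()
  edges-strict (horizontal _ ∷ cl) d fzero    fzero    ()
  edges-strict (horizontal _ ∷ cl) d fzero    (fsuc j) _       v≡pⱼ =
    ≤∧≢⇒< (edges-above cl j) λ h≡lⱼ →
      Distinct-head d (fsuc (proj₁ occ)) (trans (cong₂ _,_ v≡pⱼ h≡lⱼ) (≡-sym (proj₂ occ)))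
    where occ = edges-occur cl j
  edges-strict (horizontal _ ∷ cl) d (fsuc k) fzero    ()
  edges-strict (horizontal _ ∷ cl) d (fsuc k) (fsuc k') (s≤s p) = edges-strict cl (Distinct-tail d) k k' p
  edges-strict (vertical ∷ cl)     d                               = edges-strict cl (Distinct-tail d)

  edges-bounded : ∀ {m v h} {xs : Vec (WVert n) m} (cl : Climb (v , h) xs) →
    Bounded (h + m) (labels (edges cl))
  edges-bounded []                       ()
  edges-bounded (horizontal {h = h} _ ∷ cl) fzero    = +-monoʳ-≤ h (s≤s (size-edges≤ cl))
  edges-bounded {suc m} (horizontal {h = h} _ ∷ cl) (fsuc j) =
    +-suc-mono-≤ _ _ h m (edges-bounded cl j)
  edges-bounded {suc m} (vertical {h = h} ∷ cl) j =
    ≤-trans (edges-bounded cl j) (≤-reflexive (≡-sym (+-suc h m)))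

  edges-isTableau : ∀ {m v} {xs : Vec (WVert n) m} (cl : Climb (v , 0) xs) → Distinct ((v , 0) ∷ xs) →
    IsTableau G v m (withRoot v (edges cl))
  edges-isTableau cl d = record
    { start  = refl
    ; gpath  = edges-walk cl
    ; mono   = edges-monotone cl
    ; strict = edges-strict cl d
    ; bound  = Bounded⇒LastCond _ (edges-bounded cl)
    }

  edges-injective : ∀ {m c} {xs ys : Vec (WVert n) m} (cx : Climb c xs) (cy : Climb c ys) →
    edges cx ≡ edges cy → xs ≡ ys
  edges-injective [] [] _ = refl
  edges-injective (horizontal _ ∷ cx) (horizontal _ ∷ cy) eq
    with consEdge-injective (edges cx) (edges cy) eq
  ... | refl , eq' = cong (_ ∷_) (edges-injective cx cy eq')
  edges-injective (horizontal _ ∷ cx) (vertical ∷ cy) eq =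
    ⊥-elim (1+n≰n (subst (λ r → Above _ (labels r)) (≡-sym eq) (edges-above cy) fzero))
  edges-injective (vertical ∷ cx) (horizontal _ ∷ cy) eq =
    ⊥-elim (1+n≰n (subst (λ r → Above _ (labels r)) eq (edges-above cx) fzero))
  edges-injective (vertical ∷ cx) (vertical ∷ cy) eq = cong (_ ∷_) (edges-injective cx cy eq)

  climbAlong-climb : ∀ m {v h t} {ps : Vec (Fin n) t} {ls : Vec ℕ t} → IsWalk (Adj G) (v ∷ ps) →
    Climb (v , h) (climbAlong (v , h) m ps ls)
  climbAlong-climb zero    walk = []
  climbAlong-climb (suc m) {ps = []} {[]} walk = vertical ∷ climbAlong-climb m walk
  climbAlong-climb (suc m) {h = h} {ps = w ∷ ps} {l ∷ ls} walk with h ≟ l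
  ... | yes _ = horizontal (walk fzero) ∷ climbAlong-climb m (λ k → walk (fsuc k))
  ... | no _  = vertical ∷ climbAlong-climb m walk

  edges-climbAlong : ∀ m {v h t} {ps : Vec (Fin n) t} {ls : Vec ℕ t} (walk : IsWalk (Adj G) (v ∷ ps)) →
    Above h ls → Monotone ls → Bounded (h + m) ls →
    edges (climbAlong-climb m {h = h} {ls = ls} walk) ≡ (t , ps , ls)
  edges-climbAlong zero {ps = []} {[]} walk above mono bd = refl
  edges-climbAlong zero {h = h} {ps = w ∷ ps} {l ∷ ls} walk above mono bd =
    ⊥-elim (m+1+n≰m l (≤-trans (bd fzero) (≤-trans (≤-reflexive (+-identityʳ h)) (above fzero))))
  edges-climbAlong (suc m) {ps = []} {[]} walk above mono bd =
    edges-climbAlong m walk (λ ()) mono (λ ())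
  edges-climbAlong (suc m) {h = h} {t = suc t} {w ∷ ps} {l ∷ ls} walk above mono bd with h ≟ l
  ... | yes refl = cong (consEdge w h)
        (edges-climbAlong m (λ k → walk (fsuc k)) (λ j → above (fsuc j))
          (Monotone-tail mono) (λ j → +-suc-cancel-≤ _ t h m (bd (fsuc j))))
  ... | no h≢l = edges-climbAlong m walk (Above-suc above mono h≢l) mono
        (λ j → ≤-trans (bd j) (≤-reflexive (+-suc h m)))

  climbAlong-distinct : ∀ m {v h t} {ps : Vec (Fin n) t} {ls : Vec ℕ t} → IsWalk (Adj G) (v ∷ ps) →
    Above h ls → Monotone ls → StrictAtRepeats v ps ls →
    Distinct ((v , h) ∷ climbAlong (v , h) m ps ls)
  climbAlong-distinct zero walk above mono strict fzero fzero _ = refl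
  climbAlong-distinct (suc m) {ps = []} {[]} walk above mono strict =
    Distinct-∷ (climbAlong-avoids (suc m) {ps = []} {[]} ≤-refl (λ ()))
               (climbAlong-distinct m walk (λ ()) mono strict)
  climbAlong-distinct (suc m) {v} {h} {ps = w ∷ ps} {l ∷ ls} walk above mono strict with h ≟ l
  ... | yes refl = Distinct-∷ v∉climb
        (climbAlong-distinct m (λ k → walk (fsuc k)) (λ j → above (fsuc j)) (Monotone-tail mono)
          (λ k k' p → strict (fsuc k) (fsuc k') (s≤s p)))
    where
      v∉climb : ∀ i → (v , h) ≢ lookup ((w , h) ∷ climbAlong (w , h) m ps ls) i
      v∉climb fzero    eq = adjacent⇒≢ (walk fzero) (cong proj₁ eq)
      v∉climb (fsuc i)    = climbAlong-avoids m ≤-refl (λ j → strict fzero (fsuc j) (s≤s z≤n)) i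
  ... | no h≢l = Distinct-∷ v∉climb (climbAlong-distinct m walk (Above-suc above mono h≢l) mono strict)
    where
      v-later : ∀ j → v ≡ lookup (w ∷ ps) j → h < lookup (l ∷ ls) j
      v-later fzero    v≡w = ⊥-elim (adjacent⇒≢ (walk fzero) v≡w)
      v-later (fsuc j) _   = Above-suc above mono h≢l (fsuc j)
      v∉climb : ∀ i → (v , h) ≢ lookup ((v , suc h) ∷ climbAlong (v , suc h) m (w ∷ ps) (l ∷ ls)) i
      v∉climb fzero    eq = 1+n≰n (≤-reflexive (cong proj₂ (≡-sym eq)))
      v∉climb (fsuc i)    = climbAlong-avoids m (n≤1+n h) v-later i

  configClimb : ∀ {b ℓ x} {xs : Vec (WVert n) ℓ} → IsConfig G b ℓ (x ∷ xs) → Climb x xs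
  configClimb c = climb (IsConfig.path c) (IsConfig.heightMono c)

  fMap-isTableau : ∀ {b ℓ} (x : Vec (WVert n) (suc ℓ)) → IsConfig G b ℓ x → IsTableau G b ℓ (fMap b x)
  fMap-isTableau {b} {ℓ} (x ∷ xs) c with IsConfig.start c
  ... | refl = subst (λ r → IsTableau G b ℓ (withRoot b r)) (≡-sym (horiz≡edges cl))
                 (edges-isTableau cl (IsConfig.cycleFree c))
    where
      cl : Climb (b , 0) xs
      cl = configClimb c

  fMap-injective : ∀ {b ℓ} (x y : Vec (WVert n) (suc ℓ)) → IsConfig G b ℓ x → IsConfig G b ℓ y →
    fMap b x ≡ fMap b y → x ≡ y
  fMap-injective {b} (x ∷ xs) (y ∷ ys) cx cy eq with IsConfig.start cx | IsConfig.start cy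
  ... | refl | refl = cong ((b , 0) ∷_) (edges-injective clx cly (begin
        edges clx           ≡⟨ ≡-sym (horiz≡edges clx) ⟩
        horiz (b , 0) xs    ≡⟨ withRoot-injective (horiz (b , 0) xs) (horiz (b , 0) ys) eq ⟩
        horiz (b , 0) ys    ≡⟨ horiz≡edges cly ⟩
        edges cly           ∎))
    where
      open ≡-Reasoning
      clx : Climb (b , 0) xs
      clx = configClimb cx
      cly : Climb (b , 0) ys
      cly = configClimb cy

  fMap-surjective : ∀ {b ℓ} (T : RawTab n) → IsTableau G b ℓ T →
    Σ (Vec (WVert n) (suc ℓ)) λ x → IsConfig G b ℓ x × fMap b x ≡ T
  fMap-surjective {b} {ℓ} (t , p₀ ∷ ps , ls) tab with IsTableau.start tab
  ... | refl = (b , 0) ∷ climbAlong (b , 0) ℓ ps ls , config , realises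
    where
      open IsTableau tab
      cl : Climb (b , 0) (climbAlong (b , 0) ℓ ps ls)
      cl = climbAlong-climb ℓ gpath
      config : IsConfig G b ℓ ((b , 0) ∷ climbAlong (b , 0) ℓ ps ls)
      config = record
        { start      = refl
        ; path       = Climb⇒walk cl
        ; cycleFree  = climbAlong-distinct ℓ gpath (λ _ → z≤n) mono strict
        ; heightMono = Climb⇒ascending cl
        }
      realises : fMap b ((b , 0) ∷ climbAlong (b , 0) ℓ ps ls) ≡ (t , b ∷ ps , ls)
      realises = cong (withRoot b) (trans (horiz≡edges cl)
                   (edges-climbAlong ℓ gpath (λ _ → z≤n) mono (LastCond⇒Bounded ls mono bound)))

lemma4p5 : ∀ {n} (G : Graph n) → Connected G → (b : Fin n) (ℓ : ℕ) →
    ((x : Vec (WVert n) (suc ℓ)) → IsConfig G b ℓ x → IsTableau G b ℓ (fMap b x))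
    × ((x y : Vec (WVert n) (suc ℓ)) → IsConfig G b ℓ x → IsConfig G b ℓ y →
         fMap b x ≡ fMap b y → x ≡ y)
    × ((T : RawTab n) → IsTableau G b ℓ T →
         Σ (Vec (WVert n) (suc ℓ)) λ x → IsConfig G b ℓ x × fMap b x ≡ T)
lemma4p5 G _ b ℓ = fMap-isTableau G , fMap-injective G , fMap-surjective G
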